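{- Let $\Gamma$ be an SG-decreasing impartial game. Then for every position $x$, $\mathcal{R}(x)=1$ if $x$ is non-terminal and $\mathcal{R}(x)=0$ otherwise.
   Context: An impartial game is an acyclic digraph (positions and moves) in which from every position only finitely many positions are reachable; terminal positions have no moves; normal play. The Sprague–Grundy function is $\mathcal{G}(x)=\mathrm{mex}\{\mathcal{G}(y): x\to y\}$, where $\mathrm{mex}(S)$ is the least nonnegative integer not in $S$. The game is SG-decreasing if $\mathcal{G}(x')<\mathcal{G}(x)$ for every move $x\to x'$. Remoteness function: $\mathcal{R}(x)=0$ if $x$ is terminal; otherwise, if some move $x\to y$ has $\mathcal{R}(y)$ even, $\mathcal{R}(x)=1+\min\{\mathcal{R}(y): x\to y,\ \mathcal{R}(y)\text{ even}\}$, else $\mathcal{R}(x)=1+\max\{\mathcal{R}(y): x\to y\}$. -}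

module Defs where

open import Data.Nat using (ℕ; zero; suc; _<_; _⊓_; _⊔_)
open import Data.Nat.Properties using (_≟_)
open import Data.Bool using (Bool; true; false; if_then_else_)
open import Data.List using (List; []; _∷_; length; filter; foldr)
open import Data.List.Membership.Propositional using (_∈_; mapWith∈)
open import Data.List.Membership.DecPropositional _≟_ using (_∈?_)
open import Relation.Nullary using (yes; no; ¬_; Dec)
open import Relation.Nullary.Decidable using (⌊_⌋)
open import Relation.Binary.PropositionalEquality using (_≡_)
open import Induction.WellFounded using (WellFounded; Acc; acc)

-- An impartial game: positions, the finite list of options of each position,
-- and well-foundedness of the move relation (acyclic + finitely many
-- reachable positions).
record Game : Set₁ where
  field
    Pos   : Set
    moves : Pos → List Pos
    wf    : WellFounded (λ y x → y ∈ moves x)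

module _ (Γ : Game) where
  open Game Γ

  Terminal : Pos → Set
  Terminal x = moves x ≡ []

  NonTerminal : Pos → Set
  NonTerminal x = ¬ Terminal x

-- mex of a finite list: least n not in the list (it is ≤ length of the list).
mexAux : ℕ → ℕ → List ℕ → ℕ
mexAux zero    n xs = n
mexAux (suc f) n xs with n ∈? xs
... | yes _ = mexAux f (suc n) xs
... | no  _ = n

mex : List ℕ → ℕ
mex xs = mexAux (suc (length xs)) 0 xs

minList : ℕ → List ℕ → ℕ
minList a xs = foldr _⊓_ a xs

maxList : ℕ → List ℕ → ℕ
maxList a xs = foldr _⊔_ a xs

data Even : ℕ → Set where
  ev0  : Even 0
  ev+2 : ∀ {n} → Even n → Even (suc (suc n))

even? : (n : ℕ) → Dec (Even n)
even? 0 = yes ev0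
even? 1 = no (λ ())
even? (suc (suc n)) with even? n
... | yes e = yes (ev+2 e)
... | no ¬e = no (λ { (ev+2 e) → ¬e e })

remStep : List ℕ → ℕ
remStep []       = 0
remStep (r ∷ rs) with filter even? (r ∷ rs)
... | []     = suc (maxList r rs)
... | e ∷ es = suc (minList e es)

module _ (Γ : Game) where
  open Game Γ

  grundyAcc : (x : Pos) → Acc (λ y x → y ∈ moves x) x → ℕ
  grundyAcc x (acc rs) = mex (mapWith∈ (moves x) (λ {y} y∈ → grundyAcc y (rs y∈)))

  SG : Pos → ℕ
  SG x = grundyAcc x (wf x)

  remAcc : (x : Pos) → Acc (λ y x → y ∈ moves x) x → ℕ
  remAcc x (acc rs) = remStep (mapWith∈ (moves x) (λ {y} y∈ → remAcc y (rs y∈)))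

  Rem : Pos → ℕ
  Rem x = remAcc x (wf x)

  SG-decreasing : Set
  SG-decreasing = ∀ x y → y ∈ moves x → SG y < SG x

{-# OPTIONS --safe #-}
-- A position x with an option y has 𝒢 x > 𝒢 y ≥ 0, so by the mex property some
-- option z has 𝒢 z = 0; in an SG-decreasing game a position of value 0 can have
-- no options at all. Hence every non-terminal position has a terminal option,
-- whose remoteness 0 is even and minimal, giving remoteness 1.
module Submission where

open import Defs
open import Data.Nat using (suc; _≤_; _<_; _⊓_; z≤n; s≤s)
open import Data.Nat.Properties
  using (_≟_; ≤-refl; ≤-trans; <-≤-trans; n≤0⇒n≡0; m⊓n≤m; m⊓n≤n)
open import Data.Product using (_×_; _,_; ∃-syntax)
open import Data.List using ([]; _∷_; map; filter; foldr)
open import Data.List.Relation.Unary.Any using (here; there)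
open import Data.List.Membership.Propositional using (_∈_; mapWith∈)
open import Data.List.Membership.Propositional.Properties
  using (mapWith∈-cong; mapWith∈≗map; ∈-map⁺; ∈-map⁻; ∈-filter⁺)
open import Data.List.Membership.DecPropositional _≟_ using (_∈?_)
open import Data.Empty using (⊥-elim)
open import Relation.Nullary using (yes; no)
open import Relation.Binary.PropositionalEquality
  using (_≡_; refl; sym; trans; cong; subst; module ≡-Reasoning)
open import Induction.WellFounded using (Acc; acc)

0<mex⇒0∈ : ∀ xs → 0 < mex xs → 0 ∈ xs
0<mex⇒0∈ xs 0<mex with 0 ∈? xs
... | yes 0∈xs = 0∈xs
... | no _     with 0<mex
...   | ()

foldr-⊓-≤-init : ∀ a xs → foldr _⊓_ a xs ≤ a
foldr-⊓-≤-init a []       = ≤-refl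
foldr-⊓-≤-init a (y ∷ ys) = ≤-trans (m⊓n≤n y _) (foldr-⊓-≤-init a ys)

foldr-⊓-≤-∈ : ∀ a {x xs} → x ∈ xs → foldr _⊓_ a xs ≤ x
foldr-⊓-≤-∈ a {x} (here refl)      = m⊓n≤m x _
foldr-⊓-≤-∈ a {xs = y ∷ _} (there p) = ≤-trans (m⊓n≤n y _) (foldr-⊓-≤-∈ a p)

minList-≤ : ∀ {x} e es → x ∈ e ∷ es → minList e es ≤ x
minList-≤ e es (here refl) = foldr-⊓-≤-init e es
minList-≤ e es (there p)   = foldr-⊓-≤-∈ e p

remStep-0∈ : ∀ rs → 0 ∈ rs → remStep rs ≡ 1
remStep-0∈ (r ∷ rs) 0∈ with filter even? (r ∷ rs) in eq
... | []     with subst (0 ∈_) eq (∈-filter⁺ even? 0∈ ev0)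
...   | ()
remStep-0∈ (r ∷ rs) 0∈ | e ∷ es =
  cong suc (n≤0⇒n≡0 (minList-≤ e es (subst (0 ∈_) eq (∈-filter⁺ even? 0∈ ev0))))

module _ (Γ : Game) where
  open Game Γ

  grundyAcc-irrelevant : ∀ x (a b : Acc (λ y x → y ∈ moves x) x) →
                         grundyAcc Γ x a ≡ grundyAcc Γ x b
  grundyAcc-irrelevant x (acc rs) (acc rs′) =
    cong mex (mapWith∈-cong (moves x) _ _ (λ p → grundyAcc-irrelevant _ (rs p) (rs′ p)))

  remAcc-irrelevant : ∀ x (a b : Acc (λ y x → y ∈ moves x) x) →
                      remAcc Γ x a ≡ remAcc Γ x b
  remAcc-irrelevant x (acc rs) (acc rs′) =
    cong remStep (mapWith∈-cong (moves x) _ _ (λ p → remAcc-irrelevant _ (rs p) (rs′ p)))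

  SG-unfold : ∀ x → SG Γ x ≡ mex (map (SG Γ) (moves x))
  SG-unfold x with wf x
  ... | acc rs = begin
    mex (mapWith∈ (moves x) (λ p → grundyAcc Γ _ (rs p)))
      ≡⟨ cong mex (mapWith∈-cong (moves x) _ _ (λ p → grundyAcc-irrelevant _ (rs p) (wf _))) ⟩
    mex (mapWith∈ (moves x) (λ {y} _ → SG Γ y))
      ≡⟨ cong mex (mapWith∈≗map (SG Γ) (moves x)) ⟩
    mex (map (SG Γ) (moves x)) ∎
    where open ≡-Reasoning

  Rem-unfold : ∀ x → Rem Γ x ≡ remStep (map (Rem Γ) (moves x))
  Rem-unfold x with wf x
  ... | acc rs = begin
    remStep (mapWith∈ (moves x) (λ p → remAcc Γ _ (rs p)))
      ≡⟨ cong remStep (mapWith∈-cong (moves x) _ _ (λ p → remAcc-irrelevant _ (rs p) (wf _))) ⟩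
    remStep (mapWith∈ (moves x) (λ {y} _ → Rem Γ y))
      ≡⟨ cong remStep (mapWith∈≗map (Rem Γ) (moves x)) ⟩
    remStep (map (Rem Γ) (moves x)) ∎
    where open ≡-Reasoning

  Terminal⇒Rem≡0 : ∀ x → Terminal Γ x → Rem Γ x ≡ 0
  Terminal⇒Rem≡0 x x-terminal =
    trans (Rem-unfold x) (cong (λ ys → remStep (map (Rem Γ) ys)) x-terminal)

  module _ (decreasing : SG-decreasing Γ) where

    SG≡0⇒Terminal : ∀ z → SG Γ z ≡ 0 → Terminal Γ z
    SG≡0⇒Terminal z SGz≡0 with moves z in eq
    ... | []    = refl
    ... | w ∷ _ with subst (SG Γ w <_) SGz≡0 (decreasing z w (subst (w ∈_) (sym eq) (here refl)))
    ...   | ()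

    NonTerminal⇒0<SG : ∀ x → NonTerminal Γ x → 0 < SG Γ x
    NonTerminal⇒0<SG x x-nonterminal with moves x in eq
    ... | []    = ⊥-elim (x-nonterminal refl)
    ... | y ∷ _ = <-≤-trans (s≤s z≤n) (decreasing x y (subst (y ∈_) (sym eq) (here refl)))

    NonTerminal⇒terminal-option : ∀ x → NonTerminal Γ x → ∃[ z ] z ∈ moves x × Terminal Γ z
    NonTerminal⇒terminal-option x x-nonterminal
      with ∈-map⁻ (SG Γ) (0<mex⇒0∈ _ (subst (0 <_) (SG-unfold x) (NonTerminal⇒0<SG x x-nonterminal)))
    ... | z , z∈ , 0≡SGz = z , z∈ , SG≡0⇒Terminal z (sym 0≡SGz)

    NonTerminal⇒Rem≡1 : ∀ x → NonTerminal Γ x → Rem Γ x ≡ 1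
    NonTerminal⇒Rem≡1 x x-nonterminal with NonTerminal⇒terminal-option x x-nonterminal
    ... | z , z∈ , z-terminal =
      trans (Rem-unfold x)
            (remStep-0∈ _ (subst (_∈ map (Rem Γ) (moves x)) (Terminal⇒Rem≡0 z z-terminal) (∈-map⁺ (Rem Γ) z∈)))

mainTheorem9 : (Γ : Game) → SG-decreasing Γ →
    (x : Game.Pos Γ) →
      (NonTerminal Γ x → Rem Γ x ≡ 1) × (Terminal Γ x → Rem Γ x ≡ 0)
mainTheorem9 Γ decreasing x = NonTerminal⇒Rem≡1 Γ decreasing x , Terminal⇒Rem≡0 Γ x
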